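{- Let $\mathcal{K}$ be a class of finite $\sigma$-structures and $S$ a finite $\Gamma$-labelled forest. If there are finite $\sigma$-structures $\mathfrak{A}\in \mathcal{K}$ and $\mathfrak{B}\notin \mathcal{K}$ such that $\mathfrak{A}\leadsto_S \mathfrak{B}$, then there is no first-order sentence $\varphi$ with $qs(\varphi)\preceq_e S$ such that $\mathcal{K}$ is exactly the class of finite models of $\varphi$.
   Context: $\Gamma=\{\exists,\forall\}$; a $\Gamma$-labelled forest is a finite disjoint union of rooted directed trees (arcs from father to child) with nodes labelled $\exists$ or $\forall$. $\sigma$ is a finite signature. $(\bar c,\bar d)$ defines a partial isomorphism between $\mathfrak A$ and $\mathfrak B$ if the map $c_i\mapsto d_i$ preserves and reflects all relations of $\sigma$ and equality on these tuples and $c_i=c^{\mathfrak A}$ iff $d_i=c^{\mathfrak B}$ for every constant $c$. Game $G_S(\mathfrak A,\mathfrak B)$, with $\bar u,\bar v$ the interpretations of the constants in $\mathfrak A,\mathfrak B$: the spoiler chooses a tree of $S$ and puts a token on its root; in each round, if the token's node is labelled $\exists$ the spoiler picks in $\mathfrak A$ and the duplicator answers in $\mathfrak B$, if labelled $\forall$ the spoiler picks in $\mathfrak B$ and the duplicator answers in $\mathfrak A$; then, unless the node is a leaf, the spoiler moves the token to a child. The spoiler wins if at some point (including before the first round) the picked sequences $\bar c$ in $\mathfrak A$, $\bar d$ in $\mathfrak B$ are such that $(\bar u\bar c,\bar v\bar d)$ does not define a partial isomorphism; otherwise the duplicator wins when the round at a leaf is completed. $\mathfrak A\leadsto_S\mathfrak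 B$ means the duplicator has a winning strategy. Formulas are in negation normal form; $qs(\varphi)$: literal $\mapsto$ empty forest; conjunction/disjunction $\mapsto$ disjoint union; $\exists x\,\theta$ (resp. $\forall x\,\theta$) $\mapsto$ new $\exists$ (resp. $\forall$) node with an arc to each root of $qs(\theta)$. $S'\preceq_e S$ means there is a label-preserving, not necessarily injective node map $\iota$ such that each arc $x\to y$ of $S'$ gives a directed path of length $\ge1$ from $\iota(x)$ to $\iota(y)$ in $S$. -}

module Defs where

open import Data.Nat using (ℕ; suc; _+_)
open import Data.Fin using (Fin)
open import Data.List using (List; []; _∷_; _++_; length; lookup)
open import Data.Vec using (Vec; []; _∷_; map; tabulate; _∷ʳ_) renaming (_++_ to _++ᵛ_; lookup to lookupᵛ)
open import Data.Bool using (Bool; T)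
open import Data.Product using (Σ; _×_; _,_)
open import Data.Unit using (⊤)
open import Data.Sum using (_⊎_)
open import Relation.Nullary using (¬_)
open import Relation.Binary.PropositionalEquality using (_≡_)

record Signature : Set where
  field
    nRel   : ℕ
    arity  : Fin nRel → ℕ
    nConst : ℕ
open Signature public

-- Finite σ-structures.  The domain is Fin (suc size) (finite, nonempty).

record Structure (σ : Signature) : Set where
  field
    size  : ℕ
    rel   : (R : Fin (nRel σ)) → Vec (Fin (suc size)) (arity σ R) → Bool
    const : Fin (nConst σ) → Fin (suc size)
open Structure public

Dom : ∀ {σ} → Structure σ → Set
Dom 𝔄 = Fin (suc (size 𝔄))

consts : ∀ {σ} (𝔄 : Structure σ) → Vec (Dom 𝔄) (nConst σ)
consts 𝔄 = tabulate (const 𝔄)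

data Γ : Set where
  ∃q ∀q : Γ

data Tree : Set where
  node : Γ → List Tree → Tree

Forest : Set
Forest = List Tree

data TNode : Tree → Set where
  root : ∀ {t} → TNode t
  sub  : ∀ {l ts} (i : Fin (length ts)) → TNode (lookup ts i) → TNode (node l ts)

label : ∀ {t} → TNode t → Γ
label {node l ts} root = l
label (sub i p) = label p

data Child : {t : Tree} → TNode t → TNode t → Set where
  c-root : ∀ {l ts i} → Child {node l ts} root (sub i root)
  c-sub  : ∀ {l ts i p q} → Child {lookup ts i} p q → Child {node l ts} (sub i p) (sub i q)

data Desc : {t : Tree} → TNode t → TNode t → Set where
  d-root : ∀ {l ts i q} → Desc {node l ts} root (sub i q)
  d-sub  : ∀ {l ts i p q} → Desc {lookup ts i} p q → Desc {node l ts} (sub i p) (sub i q)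

FNode : Forest → Set
FNode f = Σ (Fin (length f)) (λ i → TNode (lookup f i))

flabel : ∀ f → FNode f → Γ
flabel f (i , p) = label p

data FChild (f : Forest) : FNode f → FNode f → Set where
  fchild : ∀ {i p q} → Child p q → FChild f (i , p) (i , q)

data FDesc (f : Forest) : FNode f → FNode f → Set where
  fdesc : ∀ {i p q} → Desc p q → FDesc f (i , p) (i , q)

-- S' ⪯ₑ S : label-preserving (not necessarily injective) node map such
-- that every arc x → y of S' yields a directed path of length ≥ 1 from
-- ι x to ι y in S.
_⪯ₑ_ : Forest → Forest → Set
S' ⪯ₑ S = Σ (FNode S' → FNode S) λ ι →
            (∀ x → flabel S (ι x) ≡ flabel S' x) ×
            (∀ x y → FChild S' x y → FDesc S (ι x) (ι y))

-- First-order formulas in negation normal form (de Bruijn variables)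

data Term (σ : Signature) (n : ℕ) : Set where
  var : Fin n → Term σ n
  con : Fin (nConst σ) → Term σ n

data Formula (σ : Signature) (n : ℕ) : Set where
  rel̇  : (R : Fin (nRel σ)) → Vec (Term σ n) (arity σ R) → Formula σ n
  nrel̇ : (R : Fin (nRel σ)) → Vec (Term σ n) (arity σ R) → Formula σ n
  eq̇   : Term σ n → Term σ n → Formula σ n
  neq̇  : Term σ n → Term σ n → Formula σ n
  _∧̇_  : Formula σ n → Formula σ n → Formula σ n
  _∨̇_  : Formula σ n → Formula σ n → Formula σ n
  ∃̇    : Formula σ (suc n) → Formula σ n
  ∀̇    : Formula σ (suc n) → Formula σ n

Sentence : Signature → Set
Sentence σ = Formula σ 0

qs : ∀ {σ n} → Formula σ n → Forest
qs (rel̇ R ts)  = []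
qs (nrel̇ R ts) = []
qs (eq̇ s t)    = []
qs (neq̇ s t)   = []
qs (φ ∧̇ ψ)     = qs φ ++ qs ψ
qs (φ ∨̇ ψ)     = qs φ ++ qs ψ
qs (∃̇ θ)       = node ∃q (qs θ) ∷ []
qs (∀̇ θ)       = node ∀q (qs θ) ∷ []

-- semantics (variable 0 is the innermost bound variable)
evalT : ∀ {σ n} (𝔄 : Structure σ) → Vec (Dom 𝔄) n → Term σ n → Dom 𝔄
evalT 𝔄 env (var x) = lookupᵛ env x
evalT 𝔄 env (con c) = const 𝔄 c

Sat : ∀ {σ n} (𝔄 : Structure σ) → Formula σ n → Vec (Dom 𝔄) n → Set
Sat 𝔄 (rel̇ R ts)  env = T (rel 𝔄 R (map (evalT 𝔄 env) ts))
Sat 𝔄 (nrel̇ R ts) env = ¬ T (rel 𝔄 R (map (evalT 𝔄 env) ts))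
Sat 𝔄 (eq̇ s t)    env = evalT 𝔄 env s ≡ evalT 𝔄 env t
Sat 𝔄 (neq̇ s t)   env = ¬ (evalT 𝔄 env s ≡ evalT 𝔄 env t)
Sat 𝔄 (φ ∧̇ ψ)     env = Sat 𝔄 φ env × Sat 𝔄 ψ env
Sat 𝔄 (φ ∨̇ ψ)     env = Sat 𝔄 φ env ⊎ Sat 𝔄 ψ env
Sat 𝔄 (∃̇ θ)       env = Σ (Dom 𝔄) λ a → Sat 𝔄 θ (a ∷ env)
Sat 𝔄 (∀̇ θ)       env = (a : Dom 𝔄) → Sat 𝔄 θ (a ∷ env)

_⊨_ : ∀ {σ} → Structure σ → Sentence σ → Set
𝔄 ⊨ φ = Sat 𝔄 φ []

record PartialIso {σ} (𝔄 𝔅 : Structure σ) {m : ℕ}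
                  (c : Vec (Dom 𝔄) m) (d : Vec (Dom 𝔅) m) : Set where
  field
    equality  : ∀ i j → (lookupᵛ c i ≡ lookupᵛ c j → lookupᵛ d i ≡ lookupᵛ d j)
                      × (lookupᵛ d i ≡ lookupᵛ d j → lookupᵛ c i ≡ lookupᵛ c j)
    relations : ∀ (R : Fin (nRel σ)) (js : Vec (Fin m) (arity σ R)) →
                  (T (rel 𝔄 R (map (lookupᵛ c) js)) → T (rel 𝔅 R (map (lookupᵛ d) js)))
                × (T (rel 𝔅 R (map (lookupᵛ d) js)) → T (rel 𝔄 R (map (lookupᵛ c) js)))
    constants : ∀ i (k : Fin (nConst σ)) →
                  (lookupᵛ c i ≡ const 𝔄 k → lookupᵛ d i ≡ const 𝔅 k)
                × (lookupᵛ d i ≡ const 𝔅 k → lookupᵛ c i ≡ const 𝔄 k)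

PI : ∀ {σ} (𝔄 𝔅 : Structure σ) {m : ℕ} → Vec (Dom 𝔄) m → Vec (Dom 𝔅) m → Set
PI 𝔄 𝔅 c d = PartialIso 𝔄 𝔅 (consts 𝔄 ++ᵛ c) (consts 𝔅 ++ᵛ d)

-- WinsT 𝔄 𝔅 t c d: the duplicator has a winning
-- strategy from the position where the token is on the root of t (round
-- not yet played) and the sequences picked so far are c̄ (in 𝔄), d̄ (in 𝔅).
-- The duplicator's answer may depend on the whole history; afterwards the
-- spoiler chooses any child (none at a leaf: then the duplicator has won).

mutual
  WinsT : ∀ {σ} (𝔄 𝔅 : Structure σ) {m : ℕ} → Tree →
          Vec (Dom 𝔄) m → Vec (Dom 𝔅) m → Set
  WinsT 𝔄 𝔅 (node ∃q ts) c d =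
    (a : Dom 𝔄) → Σ (Dom 𝔅) λ b →
      PI 𝔄 𝔅 (c ∷ʳ a) (d ∷ʳ b) × WinsF 𝔄 𝔅 ts (c ∷ʳ a) (d ∷ʳ b)
  WinsT 𝔄 𝔅 (node ∀q ts) c d =
    (b : Dom 𝔅) → Σ (Dom 𝔄) λ a →
      PI 𝔄 𝔅 (c ∷ʳ a) (d ∷ʳ b) × WinsF 𝔄 𝔅 ts (c ∷ʳ a) (d ∷ʳ b)

  WinsF : ∀ {σ} (𝔄 𝔅 : Structure σ) {m : ℕ} → Forest →
          Vec (Dom 𝔄) m → Vec (Dom 𝔅) m → Set
  WinsF 𝔄 𝔅 []       c d = ⊤
  WinsF 𝔄 𝔅 (t ∷ ts) c d = WinsT 𝔄 𝔅 t c d × WinsF 𝔄 𝔅 ts c d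

_⇝[_]_ : ∀ {σ} → Structure σ → Forest → Structure σ → Set
𝔄 ⇝[ S ] 𝔅 = PI 𝔄 𝔅 [] [] × WinsF 𝔄 𝔅 S [] []

-- A winning strategy of the duplicator in G_S(𝔄,𝔅) transfers every sentence φ with
-- qs φ ⪯ₑ S from 𝔄 to 𝔅.  One evaluates φ in 𝔄 and 𝔅 side by side, keeping for each
-- quantifier of φ its image node in S together with a position of the game, reached by
-- following the strategy, at which the duplicator still wins from that node on.  An
-- ∃-witness in 𝔄 is answered by the duplicator in 𝔅, a ∀-challenge in 𝔅 is answered in
-- 𝔄, and since the game positions are partial isomorphisms the literals agree.  As the
-- embedding only maps arcs to paths, the nodes it skips are passed by letting the spoiler
-- play arbitrary moves; these extra picks only extend the position, and partial
-- isomorphisms restrict to subsequences.  Hence 𝔄 ⊨ φ gives 𝔅 ⊨ φ, which is impossible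
-- if φ defines 𝒦, 𝔄 ∈ 𝒦 and 𝔅 ∉ 𝒦.
module Submission where

open import Defs
open import Data.Product using (Σ; _×_; _,_; proj₁; proj₂)
open import Relation.Nullary using (¬_)
open import Data.Nat using (ℕ; suc; _+_)
open import Data.Fin using (Fin; zero; suc; fromℕ; inject₁; _↑ˡ_; _↑ʳ_)
open import Data.List using ([]; _∷_; length) renaming (_++_ to _++ˡ_; lookup to lookupˡ)
open import Data.Vec using (Vec; []; _∷_; map; _∷ʳ_) renaming (_++_ to _++ᵛ_; lookup to lookupᵛ)
open import Data.Vec.Properties using (map-cong; map-∘; lookup-++ˡ; lookup-++ʳ; lookup∘tabulate)
import Data.Sum as Sum
open import Data.Bool using (T)
open import Function using (_∘_)
open import Relation.Binary.PropositionalEquality using (_≡_; refl; sym; trans; cong; subst)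

lookup-∷ʳ-fromℕ : ∀ {A : Set} {m} (c : Vec A m) a → lookupᵛ (c ∷ʳ a) (fromℕ m) ≡ a
lookup-∷ʳ-fromℕ []      a = refl
lookup-∷ʳ-fromℕ (x ∷ c) a = lookup-∷ʳ-fromℕ c a

lookup-∷ʳ-inject₁ : ∀ {A : Set} {m} (c : Vec A m) a i → lookupᵛ (c ∷ʳ a) (inject₁ i) ≡ lookupᵛ c i
lookup-∷ʳ-inject₁ (x ∷ c) a zero    = refl
lookup-∷ʳ-inject₁ (x ∷ c) a (suc i) = lookup-∷ʳ-inject₁ c a i

map-lookup-reindex : ∀ {X : Set} {m m′ r} (f : Fin m → Fin m′) (x : Vec X m) (x′ : Vec X m′) →
                     (∀ i → lookupᵛ x′ (f i) ≡ lookupᵛ x i) → (js : Vec (Fin m) r) →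
                     map (lookupᵛ x) js ≡ map (lookupᵛ x′) (map f js)
map-lookup-reindex f x x′ h js = trans (map-cong (sym ∘ h) js) (map-∘ (lookupᵛ x′) f js)

record Embeds {A B : Set} {m m′ : ℕ} (c : Vec A m) (d : Vec B m)
              (c′ : Vec A m′) (d′ : Vec B m′) : Set where
  field
    pos  : Fin m → Fin m′
    pos₁ : ∀ i → lookupᵛ c′ (pos i) ≡ lookupᵛ c i
    pos₂ : ∀ i → lookupᵛ d′ (pos i) ≡ lookupᵛ d i
open Embeds

module _ {A B : Set} where

  Embeds-refl : ∀ {m} {c : Vec A m} {d : Vec B m} → Embeds c d c d
  Embeds-refl = record { pos = λ i → i ; pos₁ = λ _ → refl ; pos₂ = λ _ → refl }

  Embeds-trans : ∀ {m m′ m″} {c : Vec A m} {d : Vec B m} {c′ : Vec A m′} {d′ : Vec B m′}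
                   {c″ : Vec A m″} {d″ : Vec B m″} →
                 Embeds c d c′ d′ → Embeds c′ d′ c″ d″ → Embeds c d c″ d″
  Embeds-trans e f = record
    { pos  = pos f ∘ pos e
    ; pos₁ = λ i → trans (pos₁ f (pos e i)) (pos₁ e i)
    ; pos₂ = λ i → trans (pos₂ f (pos e i)) (pos₂ e i)
    }

  Embeds-∷ : ∀ {m m′} {c : Vec A m} {d : Vec B m} {c′ : Vec A m′} {d′ : Vec B m′} a b →
             Embeds c d c′ d′ → Embeds (a ∷ c) (b ∷ d) (a ∷ c′) (b ∷ d′)
  Embeds-∷ a b e = record
    { pos  = λ { zero → zero ; (suc i) → suc (pos e i) }
    ; pos₁ = λ { zero → refl ; (suc i) → pos₁ e i }
    ; pos₂ = λ { zero → refl ; (suc i) → pos₂ e i }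
    }

  Embeds-++ : ∀ {p m m′} (u : Vec A p) (v : Vec B p)
                {c : Vec A m} {d : Vec B m} {c′ : Vec A m′} {d′ : Vec B m′} →
              Embeds c d c′ d′ → Embeds (u ++ᵛ c) (v ++ᵛ d) (u ++ᵛ c′) (v ++ᵛ d′)
  Embeds-++ []      []      e = e
  Embeds-++ (a ∷ u) (b ∷ v) e = Embeds-∷ a b (Embeds-++ u v e)

  Embeds-∷ʳ : ∀ {m} (c : Vec A m) (d : Vec B m) a b → Embeds c d (c ∷ʳ a) (d ∷ʳ b)
  Embeds-∷ʳ c d a b = record
    { pos = inject₁ ; pos₁ = lookup-∷ʳ-inject₁ c a ; pos₂ = lookup-∷ʳ-inject₁ d b }

  Embeds-∷-∷ʳ : ∀ {m m′} {c : Vec A m} {d : Vec B m} (c′ : Vec A m′) (d′ : Vec B m′) a b →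
                Embeds c d c′ d′ → Embeds (a ∷ c) (b ∷ d) (c′ ∷ʳ a) (d′ ∷ʳ b)
  Embeds-∷-∷ʳ {m′ = m′} c′ d′ a b e = record
    { pos  = λ { zero → fromℕ m′ ; (suc i) → inject₁ (pos e i) }
    ; pos₁ = λ { zero → lookup-∷ʳ-fromℕ c′ a
               ; (suc i) → trans (lookup-∷ʳ-inject₁ c′ a (pos e i)) (pos₁ e i) }
    ; pos₂ = λ { zero → lookup-∷ʳ-fromℕ d′ b
               ; (suc i) → trans (lookup-∷ʳ-inject₁ d′ b (pos e i)) (pos₂ e i) }
    }

subtree : ∀ {t} → TNode t → Tree
subtree {t} root      = t
subtree     (sub i p) = subtree p

children : Tree → Forest
children (node l ts) = ts

record ForestHom (F G : Forest) : Set where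
  field
    apply       : FNode F → FNode G
    apply-label : ∀ x → flabel G (apply x) ≡ flabel F x
    apply-child : ∀ {x y} → FChild F x y → FChild G (apply x) (apply y)
open ForestHom

⪯ₑ-precomp : ∀ {F G S} (h : ForestHom F G) (E : G ⪯ₑ S) → F ⪯ₑ S
⪯ₑ-precomp h (ι , ι-label , ι-arc) =
  ι ∘ apply h ,
  (λ x → trans (ι-label (apply h x)) (apply-label h x)) ,
  (λ x y ch → ι-arc (apply h x) (apply h y) (apply-child h ch))

below : ∀ l F → ForestHom F (node l F ∷ [])
below l F = record
  { apply       = λ { (i , p) → zero , sub i p }
  ; apply-label = λ _ → refl
  ; apply-child = λ { (fchild ch) → fchild (c-sub ch) }
  }

shift : ∀ {t ts} → FNode ts → FNode (t ∷ ts)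
shift (i , p) = suc i , p

shift-child : ∀ {t ts} {x y : FNode ts} → FChild ts x y → FChild (t ∷ ts) (shift x) (shift y)
shift-child (fchild ch) = fchild ch

module _ {ys : Forest} where

  inl : ∀ xs → FNode xs → FNode (xs ++ˡ ys)
  inl (x ∷ xs) (zero  , p) = zero , p
  inl (x ∷ xs) (suc i , p) = shift (inl xs (i , p))

  inl-label : ∀ xs x → flabel (xs ++ˡ ys) (inl xs x) ≡ flabel xs x
  inl-label (x ∷ xs) (zero  , p) = refl
  inl-label (x ∷ xs) (suc i , p) = inl-label xs (i , p)

  inl-child : ∀ xs {x y} → FChild xs x y → FChild (xs ++ˡ ys) (inl xs x) (inl xs y)
  inl-child (x ∷ xs) (fchild {zero}  ch) = fchild ch
  inl-child (x ∷ xs) (fchild {suc i} ch) = shift-child (inl-child xs (fchild {i = i} ch))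

  inr : ∀ xs → FNode ys → FNode (xs ++ˡ ys)
  inr []       y = y
  inr (x ∷ xs) y = shift (inr xs y)

  inr-label : ∀ xs y → flabel (xs ++ˡ ys) (inr xs y) ≡ flabel ys y
  inr-label []       y = refl
  inr-label (x ∷ xs) y = inr-label xs y

  inr-child : ∀ xs {x y} → FChild ys x y → FChild (xs ++ˡ ys) (inr xs x) (inr xs y)
  inr-child []       ch = ch
  inr-child (x ∷ xs) ch = shift-child (inr-child xs ch)

++-inl : ∀ xs ys → ForestHom xs (xs ++ˡ ys)
++-inl xs ys = record { apply = inl xs ; apply-label = inl-label xs ; apply-child = inl-child xs }

++-inr : ∀ xs ys → ForestHom ys (xs ++ˡ ys)
++-inr xs ys = record { apply = inr xs ; apply-label = inr-label xs ; apply-child = inr-child xs }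

module _ {σ : Signature} where

  termIndex : ∀ {n} → Term σ n → Fin (nConst σ + n)
  termIndex     (var x) = nConst σ ↑ʳ x
  termIndex {n} (con k) = k ↑ˡ n

  evalT-lookup : ∀ (ℭ : Structure σ) {n} (env : Vec (Dom ℭ) n) t →
                 evalT ℭ env t ≡ lookupᵛ (consts ℭ ++ᵛ env) (termIndex t)
  evalT-lookup ℭ env (var x) = sym (lookup-++ʳ (consts ℭ) env x)
  evalT-lookup ℭ env (con k) = sym (trans (lookup-++ˡ (consts ℭ) env k) (lookup∘tabulate (const ℭ) k))

  map-evalT-lookup : ∀ (ℭ : Structure σ) {n r} (env : Vec (Dom ℭ) n) (ts : Vec (Term σ n) r) →
                     map (evalT ℭ env) ts ≡ map (lookupᵛ (consts ℭ ++ᵛ env)) (map termIndex ts)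
  map-evalT-lookup ℭ env ts = trans (map-cong (evalT-lookup ℭ env) ts) (map-∘ _ termIndex ts)

  module _ (𝔄 𝔅 : Structure σ) where

    PartialIso-restrict : ∀ {m m′} {c : Vec (Dom 𝔄) m} {d : Vec (Dom 𝔅) m}
                            {c′ : Vec (Dom 𝔄) m′} {d′ : Vec (Dom 𝔅) m′} →
                          Embeds c d c′ d′ → PartialIso 𝔄 𝔅 c′ d′ → PartialIso 𝔄 𝔅 c d
    PartialIso-restrict {c = c} {d} {c′} {d′} e P = record
      { equality  = λ i j →
          (λ eq → trans (sym (pos₂ e i)) (trans (proj₁ (equality (pos e i) (pos e j))
                    (trans (pos₁ e i) (trans eq (sym (pos₁ e j))))) (pos₂ e j)))
        , (λ eq → trans (sym (pos₁ e i)) (trans (proj₂ (equality (pos e i) (pos e j))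
                    (trans (pos₂ e i) (trans eq (sym (pos₂ e j))))) (pos₁ e j)))
      ; relations = λ R js →
          (λ r → subst T (cong (rel 𝔅 R) (sym (map-lookup-reindex (pos e) d d′ (pos₂ e) js)))
                   (proj₁ (relations R (map (pos e) js)) (subst T (cong (rel 𝔄 R) (map-lookup-reindex (pos e) c c′ (pos₁ e) js)) r)))
        , (λ r → subst T (cong (rel 𝔄 R) (sym (map-lookup-reindex (pos e) c c′ (pos₁ e) js)))
                   (proj₂ (relations R (map (pos e) js)) (subst T (cong (rel 𝔅 R) (map-lookup-reindex (pos e) d d′ (pos₂ e) js)) r)))
      ; constants = λ i k →
          (λ eq → trans (sym (pos₂ e i)) (proj₁ (constants (pos e i) k) (trans (pos₁ e i) eq)))
        , (λ eq → trans (sym (pos₁ e i)) (proj₂ (constants (pos e i) k) (trans (pos₂ e i) eq)))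
      }
      where open PartialIso P

    PI-restrict : ∀ {m m′} {c : Vec (Dom 𝔄) m} {d : Vec (Dom 𝔅) m}
                    {c′ : Vec (Dom 𝔄) m′} {d′ : Vec (Dom 𝔅) m′} →
                  Embeds c d c′ d′ → PI 𝔄 𝔅 c′ d′ → PI 𝔄 𝔅 c d
    PI-restrict e = PartialIso-restrict (Embeds-++ (consts 𝔄) (consts 𝔅) e)

    module _ {n} {eA : Vec (Dom 𝔄) n} {eB : Vec (Dom 𝔅) n} (P : PI 𝔄 𝔅 eA eB) where

      PI-rel : ∀ R (ts : Vec (Term σ n) (arity σ R)) →
                 (T (rel 𝔄 R (map (evalT 𝔄 eA) ts)) → T (rel 𝔅 R (map (evalT 𝔅 eB) ts)))
               × (T (rel 𝔅 R (map (evalT 𝔅 eB) ts)) → T (rel 𝔄 R (map (evalT 𝔄 eA) ts)))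
      PI-rel R ts =
          (λ r → subst T (cong (rel 𝔅 R) (sym (map-evalT-lookup 𝔅 eB ts)))
                   (proj₁ (relations R (map termIndex ts)) (subst T (cong (rel 𝔄 R) (map-evalT-lookup 𝔄 eA ts)) r)))
        , (λ r → subst T (cong (rel 𝔄 R) (sym (map-evalT-lookup 𝔄 eA ts)))
                   (proj₂ (relations R (map termIndex ts)) (subst T (cong (rel 𝔅 R) (map-evalT-lookup 𝔅 eB ts)) r)))
        where open PartialIso P

      PI-eq : ∀ (s t : Term σ n) →
                (evalT 𝔄 eA s ≡ evalT 𝔄 eA t → evalT 𝔅 eB s ≡ evalT 𝔅 eB t)
              × (evalT 𝔅 eB s ≡ evalT 𝔅 eB t → evalT 𝔄 eA s ≡ evalT 𝔄 eA t)
      PI-eq s t =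
          (λ eq → trans (evalT-lookup 𝔅 eB s) (trans (proj₁ (equality (termIndex s) (termIndex t))
                    (trans (sym (evalT-lookup 𝔄 eA s)) (trans eq (evalT-lookup 𝔄 eA t)))) (sym (evalT-lookup 𝔅 eB t))))
        , (λ eq → trans (evalT-lookup 𝔄 eA s) (trans (proj₂ (equality (termIndex s) (termIndex t))
                    (trans (sym (evalT-lookup 𝔅 eB s)) (trans eq (evalT-lookup 𝔅 eB t)))) (sym (evalT-lookup 𝔄 eA t))))
        where open PartialIso P

    record Ext (P : ∀ {k} → Vec (Dom 𝔄) k → Vec (Dom 𝔅) k → Set) {m}
               (c : Vec (Dom 𝔄) m) (d : Vec (Dom 𝔅) m) : Set where
      constructor ext
      field
        {m′}   : ℕ
        c′     : Vec (Dom 𝔄) m′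
        d′     : Vec (Dom 𝔅) m′
        embeds : Embeds c d c′ d′
        holds  : P c′ d′

    module _ {P : ∀ {k} → Vec (Dom 𝔄) k → Vec (Dom 𝔅) k → Set} {m}
             {c : Vec (Dom 𝔄) m} {d : Vec (Dom 𝔅) m} where

      Ext-pure : P c d → Ext P c d
      Ext-pure = ext c d Embeds-refl

      Ext-weaken : ∀ {m′} {c′ : Vec (Dom 𝔄) m′} {d′ : Vec (Dom 𝔅) m′} →
                   Embeds c d c′ d′ → Ext P c′ d′ → Ext P c d
      Ext-weaken e (ext c″ d″ e′ p) = ext c″ d″ (Embeds-trans e e′) p

    Ext-bind : ∀ {P Q : ∀ {k} → Vec (Dom 𝔄) k → Vec (Dom 𝔅) k → Set} {m}
                 {c : Vec (Dom 𝔄) m} {d : Vec (Dom 𝔅) m} →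
               Ext P c d → (∀ {k} {c′ : Vec (Dom 𝔄) k} {d′ : Vec (Dom 𝔅) k} → P c′ d′ → Ext Q c′ d′) →
               Ext Q c d
    Ext-bind (ext c′ d′ e p) f = Ext-weaken e (f p)

    module _ {m} {c : Vec (Dom 𝔄) m} {d : Vec (Dom 𝔅) m} where

      WinsF-lookup : ∀ {ts} → WinsF 𝔄 𝔅 ts c d → (i : Fin (length ts)) → WinsT 𝔄 𝔅 (lookupˡ ts i) c d
      WinsF-lookup {t ∷ ts} (w , ws) zero    = w
      WinsF-lookup {t ∷ ts} (w , ws) (suc i) = WinsF-lookup ws i

      -- Domains are never empty, so the spoiler can always pass a node with a dummy move.
      some-move : ∀ l ts → WinsT 𝔄 𝔅 (node l ts) c d →
                  Σ (Dom 𝔄) λ a → Σ (Dom 𝔅) λ b → WinsF 𝔄 𝔅 ts (c ∷ʳ a) (d ∷ʳ b)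
      some-move ∃q ts w = let b , _ , ws = w zero in zero , b , ws
      some-move ∀q ts w = let a , _ , ws = w zero in a , zero , ws

    descend : ∀ {m} {c : Vec (Dom 𝔄) m} {d : Vec (Dom 𝔅) m} t (p : TNode t) →
              WinsT 𝔄 𝔅 t c d → Ext (WinsT 𝔄 𝔅 (subtree p)) c d
    descend t root w = Ext-pure w
    descend {c = c} {d} (node l ts) (sub i p) w =
      let a , b , ws = some-move l ts w
      in Ext-weaken (Embeds-∷ʳ c d a b) (descend _ p (WinsF-lookup ws i))

    descend-Desc : ∀ {m} {c : Vec (Dom 𝔄) m} {d : Vec (Dom 𝔅) m} {t} {p q : TNode t} → Desc p q →
                   WinsF 𝔄 𝔅 (children (subtree p)) c d → Ext (WinsT 𝔄 𝔅 (subtree q)) c d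
    descend-Desc (d-root {i = i} {q = q}) ws = descend _ q (WinsF-lookup ws i)
    descend-Desc (d-sub pq)               ws = descend-Desc pq ws

    descend-FDesc : ∀ {m} {c : Vec (Dom 𝔄) m} {d : Vec (Dom 𝔅) m} {S} {x y : FNode S} → FDesc S x y →
                    WinsF 𝔄 𝔅 (children (subtree (proj₂ x))) c d → Ext (WinsT 𝔄 𝔅 (subtree (proj₂ y))) c d
    descend-FDesc (fdesc pq) = descend-Desc pq

    module _ {n} {eA : Vec (Dom 𝔄) n} {eB : Vec (Dom 𝔅) n} where

      respond∃ : ∀ {t} (p : TNode t) → label p ≡ ∃q → Ext (WinsT 𝔄 𝔅 (subtree p)) eA eB →
                 ∀ a → Σ (Dom 𝔅) λ b →
                   PI 𝔄 𝔅 (a ∷ eA) (b ∷ eB) × Ext (WinsF 𝔄 𝔅 (children (subtree p))) (a ∷ eA) (b ∷ eB)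
      respond∃ {node ∃q ts} root refl (ext c d e w) a =
        let b , P , ws = w a
            e′ = Embeds-∷-∷ʳ c d a b e
        in b , PI-restrict e′ P , ext _ _ e′ ws
      respond∃ (sub i p) = respond∃ p

      respond∀ : ∀ {t} (p : TNode t) → label p ≡ ∀q → Ext (WinsT 𝔄 𝔅 (subtree p)) eA eB →
                 ∀ b → Σ (Dom 𝔄) λ a →
                   PI 𝔄 𝔅 (a ∷ eA) (b ∷ eB) × Ext (WinsF 𝔄 𝔅 (children (subtree p))) (a ∷ eA) (b ∷ eB)
      respond∀ {node ∀q ts} root refl (ext c d e w) b =
        let a , P , ws = w b
            e′ = Embeds-∷-∷ʳ c d a b e
        in a , PI-restrict e′ P , ext _ _ e′ ws
      respond∀ (sub i p) = respond∀ p

    module _ (S : Forest) where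

      Covers : ∀ {n} (F : Forest) → (FNode F → FNode S) → Vec (Dom 𝔄) n → Vec (Dom 𝔅) n → Set
      Covers F ι eA eB = ∀ i → Ext (WinsT 𝔄 𝔅 (subtree (proj₂ (ι (i , root))))) eA eB

      Covers-initial : WinsF 𝔄 𝔅 S [] [] → ∀ F ι → Covers F ι [] []
      Covers-initial w F ι i = descend _ (proj₂ (ι (i , root))) (WinsF-lookup w (proj₁ (ι (i , root))))

      module _ {n} {eA : Vec (Dom 𝔄) n} {eB : Vec (Dom 𝔅) n} where

        Covers-++ˡ : ∀ xs {ys ι} → Covers (xs ++ˡ ys) ι eA eB → Covers xs (ι ∘ inl xs) eA eB
        Covers-++ˡ (x ∷ xs) cov zero    = cov zero
        Covers-++ˡ (x ∷ xs) {ι = ι} cov (suc i) = Covers-++ˡ xs {ι = ι ∘ shift} (cov ∘ suc) i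

        Covers-++ʳ : ∀ xs {ys ι} → Covers (xs ++ˡ ys) ι eA eB → Covers ys (ι ∘ inr xs) eA eB
        Covers-++ʳ []       cov = cov
        Covers-++ʳ (x ∷ xs) {ι = ι} cov = Covers-++ʳ xs {ι = ι ∘ shift} (cov ∘ suc)

        Covers-below : ∀ {l F} (E : (node l F ∷ []) ⪯ₑ S) →
                       Ext (WinsF 𝔄 𝔅 (children (subtree (proj₂ (proj₁ E (zero , root)))))) eA eB →
                       Covers F (proj₁ E ∘ apply (below l F)) eA eB
        Covers-below (ι , _ , ι-arc) ws i =
          Ext-bind ws (descend-FDesc (ι-arc (zero , root) (zero , sub i root) (fchild c-root)))

      transfer : ∀ {n} (ψ : Formula σ n) (E : qs ψ ⪯ₑ S) {eA : Vec (Dom 𝔄) n} {eB : Vec (Dom 𝔅) n} →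
                 PI 𝔄 𝔅 eA eB → Covers (qs ψ) (proj₁ E) eA eB → Sat 𝔄 ψ eA → Sat 𝔅 ψ eB
      transfer (rel̇ R ts)  E P cov   = proj₁ (PI-rel P R ts)
      transfer (nrel̇ R ts) E P cov r = r ∘ proj₂ (PI-rel P R ts)
      transfer (eq̇ s t)    E P cov   = proj₁ (PI-eq P s t)
      transfer (neq̇ s t)   E P cov r = r ∘ proj₂ (PI-eq P s t)
      transfer (ψ ∧̇ χ) E P cov (r , r′) =
        transfer ψ (⪯ₑ-precomp (++-inl (qs ψ) (qs χ)) E) P (Covers-++ˡ (qs ψ) {ι = proj₁ E} cov) r ,
        transfer χ (⪯ₑ-precomp (++-inr (qs ψ) (qs χ)) E) P (Covers-++ʳ (qs ψ) {ι = proj₁ E} cov) r′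
      transfer (ψ ∨̇ χ) E P cov =
        Sum.map (transfer ψ (⪯ₑ-precomp (++-inl (qs ψ) (qs χ)) E) P (Covers-++ˡ (qs ψ) {ι = proj₁ E} cov))
                (transfer χ (⪯ₑ-precomp (++-inr (qs ψ) (qs χ)) E) P (Covers-++ʳ (qs ψ) {ι = proj₁ E} cov))
      transfer (∃̇ θ) E@(ι , ι-label , _) P cov (a , r) =
        let b , P′ , ws = respond∃ (proj₂ (ι (zero , root))) (ι-label (zero , root)) (cov zero) a
        in b , transfer θ (⪯ₑ-precomp (below ∃q (qs θ)) E) P′ (Covers-below E ws) r
      transfer (∀̇ θ) E@(ι , ι-label , _) P cov f b =
        let a , P′ , ws = respond∀ (proj₂ (ι (zero , root))) (ι-label (zero , root)) (cov zero) b
        in transfer θ (⪯ₑ-precomp (below ∀q (qs θ)) E) P′ (Covers-below E ws) (f a)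

⇝-preserves-⊨ : ∀ {σ} {𝔄 𝔅 : Structure σ} {S} → 𝔄 ⇝[ S ] 𝔅 →
                (φ : Sentence σ) → qs φ ⪯ₑ S → 𝔄 ⊨ φ → 𝔅 ⊨ φ
⇝-preserves-⊨ {𝔄 = 𝔄} {𝔅} {S} (P , w) φ E =
  transfer 𝔄 𝔅 S φ E P (Covers-initial 𝔄 𝔅 S w (qs φ) (proj₁ E))

corollary3p9 : (σ : Signature) (𝒦 : Structure σ → Set) (S : Forest)
               (𝔄 𝔅 : Structure σ) → 𝒦 𝔄 → ¬ 𝒦 𝔅 → 𝔄 ⇝[ S ] 𝔅 →
               ¬ (Σ (Sentence σ) λ φ → (qs φ ⪯ₑ S) ×
                    ((ℭ : Structure σ) → (𝒦 ℭ → ℭ ⊨ φ) × (ℭ ⊨ φ → 𝒦 ℭ)))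
corollary3p9 σ 𝒦 S 𝔄 𝔅 𝔄∈𝒦 𝔅∉𝒦 𝔄⇝𝔅 (φ , E , φ-defines-𝒦) =
  𝔅∉𝒦 (proj₂ (φ-defines-𝒦 𝔅) (⇝-preserves-⊨ 𝔄⇝𝔅 φ E (proj₁ (φ-defines-𝒦 𝔄) 𝔄∈𝒦)))
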